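{- Let $S$ be a resource monad with symmetric tensor and $A$ a small category. If a $\lambda$-term $M$ is typable in the system $E^S_A$ (i.e. some judgment $\Delta\vdash M:a$ is derivable, with $\Delta$ a context on a list of distinct variables containing $\mathrm{FV}(M)$), then the head reduction of $M$ ends.
   Context: Resource monad: fix a class $\mathcal{C}$ of functions between finite ordinals $[m]=\{1,\dots,m\}$: bijections, injections, surjections, or all functions. For a category $C$, $SC$ has objects finite lists of objects of $C$; morphisms $\langle c_1,\dots,c_n\rangle\to\langle c'_1,\dots,c'_m\rangle$ are $\langle\alpha,f_1,\dots,f_m\rangle$ with $\alpha:[m]\to[n]$ in $\mathcal{C}$, $f_i:c_{\alpha(i)}\to c'_i$; composition $\langle\beta,\vec g\rangle\circ\langle\alpha,\vec f\rangle=\langle\alpha\circ\beta,(g_i\circ f_{\beta(i)})_i\rangle$; $\oplus$ is concatenation. Types: $D=D_A$ has objects $a::=o\in\mathrm{Ob}(A)\mid\vec a\Rightarrow a$ and morphisms generated by morphisms of $A$ and, for $\langle\alpha,\vec f\rangle:\vec a'\to\vec a$ in $SD$ and $f:a\to a'$, $\langle\alpha,\vec f\rangle\Rightarrow f:(\vec a\Rightarrow a)\to(\vec a'\Rightarrow a')$. Contexts: objects of $(SD)^n$, written $x_1:\vec a_1,\dots,x_n:\vec a_n$, with $\otimes$ componentwise concatenation. Type system $E^S_A$: (var) from $f_j:\vec a_j\to\langle\rangle$ ($j\ne i$) and $f_i:\vec a_i\to\langle a\rangle$ in $SD$ derive $x_1:\vec a_1,\dots,x_n:\vec a_n\vdash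 x_i:a$; (abs) from $\Delta,x:\vec a\vdash M:a$ derive $\Delta\vdash\lambda x.M:\vec a\Rightarrow a$; (app) from $\Gamma_0\vdash M:\langle a_1,\dots,a_k\rangle\Rightarrow a$, $\Gamma_i\vdash N:a_i$ ($1\le i\le k$) and a morphism $\eta:\Delta\to\bigotimes_{j=0}^k\Gamma_j$ in $(SD)^n$ derive $\Delta\vdash MN:a$. Head reduct: $H(M)=M$ if $M=\lambda\vec x.\,x\vec N$, $H(M)=\lambda\vec x.\,M'[N/x]\vec N$ if $M=\lambda\vec x.(\lambda x.M')N\vec N$; the head reduction of $M$ ends if iterating $H$ from $M$ reaches a fixed point of $H$. -}

module Defs where

open import Data.Nat using (ℕ; zero; suc)
open import Data.Fin using (Fin; zero; suc)
open import Data.List using (List; []; _∷_; length; lookup; _++_)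
open import Data.Vec using (Vec; []; _∷_; replicate; zipWith)
import Data.Vec as Vec
open import Data.Product using (Σ; ∃; _×_; _,_)
open import Relation.Binary.PropositionalEquality using (_≡_)
open import Relation.Nullary using (¬_)

-- Small categories (objects and hom-sets in Set = Set₀)

record Category : Set₁ where
  field
    Obj  : Set
    Hom  : Obj → Obj → Set
    idC  : ∀ {o} → Hom o o
    _∘C_ : ∀ {o p q} → Hom p q → Hom o p → Hom o q
    idˡ  : ∀ {o p} (f : Hom o p) → idC ∘C f ≡ f
    idʳ  : ∀ {o p} (f : Hom o p) → f ∘C idC ≡ f
    assoc : ∀ {o p q r} (h : Hom q r) (g : Hom p q) (f : Hom o p) →
            (h ∘C g) ∘C f ≡ h ∘C (g ∘C f)

-- The class 𝒞 of functions between finite ordinals [m] = Fin m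

data FunClass : Set where
  bijections injections surjections allFunctions : FunClass

IsInjective : ∀ {m n} → (Fin m → Fin n) → Set
IsInjective f = ∀ x y → f x ≡ f y → x ≡ y

IsSurjective : ∀ {m n} → (Fin m → Fin n) → Set
IsSurjective f = ∀ y → ∃ λ x → f x ≡ y

record Unit : Set where
  constructor tt

InClass : FunClass → ∀ {m n} → (Fin m → Fin n) → Set
InClass bijections   f = IsInjective f × IsSurjective f
InClass injections   f = IsInjective f
InClass surjections  f = IsSurjective f
InClass allFunctions f = Unit

-- Untyped λ-terms, well-scoped de Bruijn (Term n : free variables ⊆ n)

data Term (n : ℕ) : Set where
  var : Fin n → Term n
  lam : Term (suc n) → Term n
  app : Term n → Term n → Term n

Ren : ℕ → ℕ → Set
Ren m n = Fin m → Fin n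

liftRen : ∀ {m n} → Ren m n → Ren (suc m) (suc n)
liftRen ρ zero    = zero
liftRen ρ (suc i) = suc (ρ i)

rename : ∀ {m n} → Ren m n → Term m → Term n
rename ρ (var x)   = var (ρ x)
rename ρ (lam M)   = lam (rename (liftRen ρ) M)
rename ρ (app M N) = app (rename ρ M) (rename ρ N)

Sub : ℕ → ℕ → Set
Sub m n = Fin m → Term n

liftSub : ∀ {m n} → Sub m n → Sub (suc m) (suc n)
liftSub σ zero    = var zero
liftSub σ (suc i) = rename suc (σ i)

subst : ∀ {m n} → Sub m n → Term m → Term n
subst σ (var x)   = σ x
subst σ (lam M)   = lam (subst (liftSub σ) M)
subst σ (app M N) = app (subst σ M) (subst σ N)

-- M [ N / x ] where x is the variable bound at index zero
_[_] : ∀ {n} → Term (suc n) → Term n → Term n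
M [ N ] = subst σ M
  where
  σ : Sub _ _
  σ zero    = N
  σ (suc i) = var i

-- Head reduct H
--   H (λx⃗. x N⃗)          = λx⃗. x N⃗
--   H (λx⃗. (λx.M') N N⃗)  = λx⃗. M'[N/x] N⃗

mutual
  H : ∀ {n} → Term n → Term n
  H (var x)   = var x
  H (lam M)   = lam (H M)
  H (app M N) = Happ M N

  Happ : ∀ {n} → Term n → Term n → Term n
  Happ (var x)     N = app (var x) N
  Happ (lam M')    N = M' [ N ]
  Happ (app M₁ M₂) N = app (Happ M₁ M₂) N

iterate : ∀ {A : Set} → (A → A) → ℕ → A → A
iterate f zero    a = a
iterate f (suc k) a = f (iterate f k a)

HeadReductionEnds : ∀ {n} → Term n → Set
HeadReductionEnds M = ∃ λ k → H (iterate H k M) ≡ iterate H k M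

module System (𝒞 : FunClass) (A : Category) where
  open Category A

  data Ty : Set where
    base : Obj → Ty
    _⇒_  : List Ty → Ty → Ty

  mutual
    data DHom : Ty → Ty → Set where
      baseHom : ∀ {o o'} → Hom o o' → DHom (base o) (base o')
      arrHom  : ∀ {as as' a a'} → SDHom as' as → DHom a a' →
                DHom (as ⇒ a) (as' ⇒ a')

    data SDHom (cs cs' : List Ty) : Set where
      sdHom : (α : Fin (length cs') → Fin (length cs)) → InClass 𝒞 α →
              ((i : Fin (length cs')) → DHom (lookup cs (α i)) (lookup cs' i)) →
              SDHom cs cs'

  Ctx : ℕ → Set
  Ctx n = Vec (List Ty) n

  _⊗_ : ∀ {n} → Ctx n → Ctx n → Ctx n
  Γ ⊗ Γ' = zipWith _++_ Γ Γ'

  ⨂ : ∀ {n k} → (Fin k → Ctx n) → Ctx n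
  ⨂ {n} {zero}  Γs = replicate n []
  ⨂ {n} {suc k} Γs = Γs zero ⊗ ⨂ (λ i → Γs (suc i))

  CtxHom : ∀ {n} → Ctx n → Ctx n → Set
  CtxHom {n} Δ Γ = (j : Fin n) → SDHom (Vec.lookup Δ j) (Vec.lookup Γ j)

  -- typing judgments Δ ⊢ M : a  (the newest variable is index zero)
  data _⊢_∶_ : ∀ {n} → Ctx n → Term n → Ty → Set where
    tvar : ∀ {n} {Δ : Ctx n} (i : Fin n) {a : Ty} →
           ((j : Fin n) → ¬ (j ≡ i) → SDHom (Vec.lookup Δ j) []) →
           SDHom (Vec.lookup Δ i) (a ∷ []) →
           Δ ⊢ var i ∶ a
    tabs : ∀ {n} {Δ : Ctx n} {as : List Ty} {a : Ty} {M : Term (suc n)} →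
           (as ∷ Δ) ⊢ M ∶ a →
           Δ ⊢ lam M ∶ (as ⇒ a)
    tapp : ∀ {n} {Δ Γ₀ : Ctx n} {as : List Ty} {a : Ty} {M N : Term n} →
           Γ₀ ⊢ M ∶ (as ⇒ a) →
           (Γs : Fin (length as) → Ctx n) →
           ((i : Fin (length as)) → Γs i ⊢ N ∶ lookup as i) →
           CtxHom Δ (Γ₀ ⊗ ⨂ Γs) →
           Δ ⊢ app M N ∶ a

  Typable : ∀ {n} → Term n → Set
  Typable {n} M = Σ (Ctx n) λ Δ → Σ Ty λ a → Δ ⊢ M ∶ a

module Submission where

-- Head normalisation for the resource type system E^S_A, by reducibility
-- candidates (Tait's method).
--
-- Every type a of D_A is interpreted as a predicate R a on terms: at a base
-- type R a is "head-normalising" (HN), and at a ⇒ b it is HN together with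
-- "applied (in any larger scope) to an argument reducible at every type of
-- the list a, the result is reducible at b".  A list of types is interpreted
-- by the conjunction RL of its members.
-- The theorem follows by instantiating the fundamental lemma at the
-- identity substitution, which is reducible since variables are neutral.

open import Defs
open import Data.Nat using (ℕ; zero; suc)
open import Data.Fin using (Fin; zero; suc)
open import Data.List using (List; []; _∷_; length; lookup; _++_)
open import Data.Vec using (_∷_)
import Data.Vec as Vec
open import Data.Vec.Properties using (lookup-zipWith)
open import Data.Product using (_×_; _,_; proj₁; proj₂)
open import Data.Unit using (⊤; tt)
open import Function using (id; _∘_)
open import Relation.Binary.PropositionalEquality
  using (_≡_; _≗_; refl; sym; trans; cong; cong₂)
  renaming (subst to transport)
open Relation.Binary.PropositionalEquality.≡-Reasoning

liftRen-ext : ∀ {m n} {ρ ρ' : Ren m n} → ρ ≗ ρ' → liftRen ρ ≗ liftRen ρ'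
liftRen-ext e zero    = refl
liftRen-ext e (suc i) = cong suc (e i)

rename-ext : ∀ {m n} {ρ ρ' : Ren m n} → ρ ≗ ρ' → rename ρ ≗ rename ρ'
rename-ext e (var x)   = cong var (e x)
rename-ext e (lam M)   = cong lam (rename-ext (liftRen-ext e) M)
rename-ext e (app M N) = cong₂ app (rename-ext e M) (rename-ext e N)

liftSub-ext : ∀ {m n} {σ σ' : Sub m n} → σ ≗ σ' → liftSub σ ≗ liftSub σ'
liftSub-ext e zero    = refl
liftSub-ext e (suc i) = cong (rename suc) (e i)

subst-ext : ∀ {m n} {σ σ' : Sub m n} → σ ≗ σ' → subst σ ≗ subst σ'
subst-ext e (var x)   = e x
subst-ext e (lam M)   = cong lam (subst-ext (liftSub-ext e) M)
subst-ext e (app M N) = cong₂ app (subst-ext e M) (subst-ext e N)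

rename-id : ∀ {n} (M : Term n) → rename id M ≡ M
rename-id (var x)   = refl
rename-id (lam M)   =
  cong lam (trans (rename-ext (λ { zero → refl ; (suc i) → refl }) M) (rename-id M))
rename-id (app M N) = cong₂ app (rename-id M) (rename-id N)

subst-id : ∀ {n} (M : Term n) → subst var M ≡ M
subst-id (var x)   = refl
subst-id (lam M)   =
  cong lam (trans (subst-ext (λ { zero → refl ; (suc i) → refl }) M) (subst-id M))
subst-id (app M N) = cong₂ app (subst-id M) (subst-id N)

rename-rename : ∀ {k m n} (ρ : Ren m n) (ρ' : Ren k m) M →
                rename ρ (rename ρ' M) ≡ rename (ρ ∘ ρ') M
rename-rename ρ ρ' (var x)   = refl
rename-rename ρ ρ' (lam M)   = cong lam (trans (rename-rename (liftRen ρ) (liftRen ρ') M)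
  (rename-ext (λ { zero → refl ; (suc i) → refl }) M))
rename-rename ρ ρ' (app M N) = cong₂ app (rename-rename ρ ρ' M) (rename-rename ρ ρ' N)

subst-rename : ∀ {k m n} (σ : Sub m n) (ρ : Ren k m) M →
               subst σ (rename ρ M) ≡ subst (σ ∘ ρ) M
subst-rename σ ρ (var x)   = refl
subst-rename σ ρ (lam M)   = cong lam (trans (subst-rename (liftSub σ) (liftRen ρ) M)
  (subst-ext (λ { zero → refl ; (suc i) → refl }) M))
subst-rename σ ρ (app M N) = cong₂ app (subst-rename σ ρ M) (subst-rename σ ρ N)

rename-liftSub : ∀ {k m n} (ρ : Ren m n) (σ : Sub k m) →
                 rename (liftRen ρ) ∘ liftSub σ ≗ liftSub (rename ρ ∘ σ)
rename-liftSub ρ σ zero    = refl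
rename-liftSub ρ σ (suc i) =
  trans (rename-rename (liftRen ρ) suc (σ i)) (sym (rename-rename suc ρ (σ i)))

rename-subst : ∀ {k m n} (ρ : Ren m n) (σ : Sub k m) M →
               rename ρ (subst σ M) ≡ subst (rename ρ ∘ σ) M
rename-subst ρ σ (var x)   = refl
rename-subst ρ σ (lam M)   = cong lam (trans (rename-subst (liftRen ρ) (liftSub σ) M)
  (subst-ext (rename-liftSub ρ σ) M))
rename-subst ρ σ (app M N) = cong₂ app (rename-subst ρ σ M) (rename-subst ρ σ N)

subst-subst : ∀ {k m n} (τ : Sub m n) (σ : Sub k m) M →
              subst τ (subst σ M) ≡ subst (subst τ ∘ σ) M
subst-subst τ σ (var x)   = refl
subst-subst τ σ (lam M)   = cong lam (trans (subst-subst (liftSub τ) (liftSub σ) M)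
  (subst-ext (λ { zero → refl ; (suc i) → lifted i }) M))
  where
  lifted : ∀ i → subst (liftSub τ) (rename suc (σ i)) ≡ rename suc (subst τ (σ i))
  lifted i = trans (subst-rename (liftSub τ) suc (σ i)) (sym (rename-subst suc τ (σ i)))
subst-subst τ σ (app M N) = cong₂ app (subst-subst τ σ M) (subst-subst τ σ N)

ext : ∀ {m n} → Term n → Sub m n → Sub (suc m) n
ext N σ zero    = N
ext N σ (suc i) = σ i

subst-beta : ∀ {m n} (σ : Sub m n) (M : Term (suc m)) N →
             (subst (liftSub σ) M) [ N ] ≡ subst (ext N σ) M
subst-beta σ M N = trans (subst-subst _ (liftSub σ) M)
  (subst-ext (λ { zero → refl ; (suc i) →
     trans (subst-rename _ suc (σ i)) (subst-id (σ i)) }) M)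

-- Renaming commutes with β-contraction: both sides are the substitution
-- ext (rename ρ N) (var ∘ ρ), up to pointwise equality.
rename-beta : ∀ {m n} (ρ : Ren m n) (M : Term (suc m)) N →
              rename ρ (M [ N ]) ≡ (rename (liftRen ρ) M) [ rename ρ N ]
rename-beta ρ M N = begin
  rename ρ (M [ N ])                     ≡⟨ rename-subst ρ _ M ⟩
  subst _ M                              ≡⟨ subst-ext (λ { zero → refl ; (suc i) → refl }) M ⟩
  subst (ext (rename ρ N) (var ∘ ρ)) M   ≡⟨ subst-ext (λ { zero → refl ; (suc i) → refl }) M ⟩
  subst _ M                              ≡⟨ subst-rename _ (liftRen ρ) M ⟨
  (rename (liftRen ρ) M) [ rename ρ N ]  ∎

data HN {n} (M : Term n) : Set where
  done : H M ≡ M → HN M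
  step : HN (H M) → HN M

iterate-shift : ∀ {A : Set} (f : A → A) k a → iterate f k (f a) ≡ iterate f (suc k) a
iterate-shift f zero    a = refl
iterate-shift f (suc k) a = cong f (iterate-shift f k a)

HN⇒ends : ∀ {n} {M : Term n} → HN M → HeadReductionEnds M
HN⇒ends (done fixed) = 0 , fixed
HN⇒ends {M = M} (step h) with HN⇒ends h
... | k , fixed = suc k , transport (λ t → H t ≡ t) (iterate-shift H k M) fixed

mutual
  H-rename : ∀ {m n} (ρ : Ren m n) M → rename ρ (H M) ≡ H (rename ρ M)
  H-rename ρ (var x)   = refl
  H-rename ρ (lam M)   = cong lam (H-rename (liftRen ρ) M)
  H-rename ρ (app M N) = Happ-rename ρ M N

  Happ-rename : ∀ {m n} (ρ : Ren m n) M N →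
                rename ρ (Happ M N) ≡ Happ (rename ρ M) (rename ρ N)
  Happ-rename ρ (var x)     N = refl
  Happ-rename ρ (lam M)     N = rename-beta ρ M N
  Happ-rename ρ (app M₁ M₂) N = cong (λ t → app t (rename ρ N)) (Happ-rename ρ M₁ M₂)

HN-rename : ∀ {m n} (ρ : Ren m n) {M} → HN M → HN (rename ρ M)
HN-rename ρ {M} (done fixed) = done (trans (sym (H-rename ρ M)) (cong (rename ρ) fixed))
HN-rename ρ {M} (step h)     = step (transport HN (H-rename ρ M) (HN-rename ρ h))

HN-lam : ∀ {n} {M : Term (suc n)} → HN M → HN (lam M)
HN-lam (done fixed) = done (cong lam fixed)
HN-lam (step h)     = step (HN-lam h)

data Neutral {n} : Term n → Set where
  nvar : ∀ x → Neutral (var x)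
  napp : ∀ {M} N → Neutral M → Neutral (app M N)

Neutral-rename : ∀ {m n} (ρ : Ren m n) {M} → Neutral M → Neutral (rename ρ M)
Neutral-rename ρ (nvar x)    = nvar (ρ x)
Neutral-rename ρ (napp N ne) = napp (rename ρ N) (Neutral-rename ρ ne)

Neutral-fixed : ∀ {n} {M : Term n} → Neutral M → H M ≡ M
Neutral-fixed (nvar x)               = refl
Neutral-fixed (napp N (nvar x))      = refl
Neutral-fixed (napp N (napp N' ne)) = cong (λ t → app t N) (Neutral-fixed (napp N' ne))

module Reducibility (𝒞 : FunClass) (A : Category) where
  open System 𝒞 A

  -- Reducibility at a type (R) and at every type of a list (RL).  The
  -- arrow clause quantifies over renamings into larger scopes, which makes
  -- R stable under weakening (needed to go under λ).
  mutual
    R : Ty → ∀ {n} → Term n → Set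
    R (base o) M     = HN M
    R (as ⇒ a) {n} M =
      HN M × (∀ {k} (ρ : Ren n k) N → RL as N → R a (app (rename ρ M) N))

    RL : List Ty → ∀ {n} → Term n → Set
    RL []       N = ⊤
    RL (b ∷ bs) N = R b N × RL bs N

  R⇒HN : ∀ a {n} {M : Term n} → R a M → HN M
  R⇒HN (base o) r = r
  R⇒HN (as ⇒ a) r = proj₁ r

  R-neutral : ∀ a {n} {M : Term n} → Neutral M → R a M
  R-neutral (base o) ne = done (Neutral-fixed ne)
  R-neutral (as ⇒ a) ne =
    done (Neutral-fixed ne) , λ ρ N _ → R-neutral a (napp N (Neutral-rename ρ ne))

  R-expand : ∀ a {n} (X Y : Term n) → R a (Happ X Y) → R a (app X Y)
  R-expand (base o) X Y r       = step r
  R-expand (as ⇒ a) X Y (h , f) = step h , λ ρ N rs →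
    R-expand a (app (rename ρ X) (rename ρ Y)) N
      (transport (λ t → R a (app t N)) (Happ-rename ρ X Y) (f ρ N rs))

  mutual
    R-rename : ∀ a {m n} (ρ : Ren m n) {M} → R a M → R a (rename ρ M)
    R-rename (base o) ρ r           = HN-rename ρ r
    R-rename (as ⇒ a) ρ {M} (h , f) = HN-rename ρ h , λ ρ' N rs →
      transport (λ t → R a (app t N)) (sym (rename-rename ρ' ρ M)) (f (ρ' ∘ ρ) N rs)

    RL-rename : ∀ as {m n} (ρ : Ren m n) {M} → RL as M → RL as (rename ρ M)
    RL-rename []       ρ r        = tt
    RL-rename (b ∷ bs) ρ (r , rs) = R-rename b ρ r , RL-rename bs ρ rs

  RL-lookup : ∀ cs {n} {N : Term n} → RL cs N → (i : Fin (length cs)) → R (lookup cs i) N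
  RL-lookup (c ∷ cs) (r , rs) zero    = r
  RL-lookup (c ∷ cs) (r , rs) (suc i) = RL-lookup cs rs i

  RL-tabulate : ∀ cs {n} {N : Term n} →
                ((i : Fin (length cs)) → R (lookup cs i) N) → RL cs N
  RL-tabulate []       f = tt
  RL-tabulate (c ∷ cs) f = f zero , RL-tabulate cs (f ∘ suc)

  RL-++ : ∀ xs ys {n} {N : Term n} → RL (xs ++ ys) N → RL xs N × RL ys N
  RL-++ []       ys r        = tt , r
  RL-++ (x ∷ xs) ys (r , rs) = let (p , q) = RL-++ xs ys rs in (r , p) , q

  -- A morphism ⟨α, f⃗⟩ : cs → cs' only reindexes (by α, whatever its
  -- class 𝒞) and transports each component, so the resource structure never
  -- obstructs reducibility.
  mutual
    R-map : ∀ {a a'} → DHom a a' → ∀ {n} {M : Term n} → R a M → R a' M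
    R-map (baseHom f)  r       = r
    R-map (arrHom g f) (h , k) = h , λ ρ N rs → R-map f (k ρ N (RL-map g rs))

    RL-map : ∀ {cs cs'} → SDHom cs cs' → ∀ {n} {N : Term n} → RL cs N → RL cs' N
    RL-map {cs} {cs'} (sdHom α _ f) rs =
      RL-tabulate cs' (λ i → R-map (f i) (RL-lookup cs rs (α i)))

  Reducible : ∀ {m n} → Ctx m → Sub m n → Set
  Reducible Δ σ = ∀ j → RL (Vec.lookup Δ j) (σ j)

  Reducible-map : ∀ {m n} (Δ Γ : Ctx m) {σ : Sub m n} →
                  CtxHom Δ Γ → Reducible Δ σ → Reducible Γ σ
  Reducible-map Δ Γ η e j = RL-map (η j) (e j)

  Reducible-⊗ : ∀ {m n} (Γ Γ' : Ctx m) {σ : Sub m n} →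
                Reducible (Γ ⊗ Γ') σ → Reducible Γ σ × Reducible Γ' σ
  Reducible-⊗ Γ Γ' e = (proj₁ ∘ split) , (proj₂ ∘ split)
    where
    split : ∀ j → RL (Vec.lookup Γ j) _ × RL (Vec.lookup Γ' j) _
    split j = RL-++ (Vec.lookup Γ j) (Vec.lookup Γ' j)
      (transport (λ l → RL l _) (lookup-zipWith _++_ j Γ Γ') (e j))

  Reducible-⨂ : ∀ {m n k} (Γs : Fin k → Ctx m) {σ : Sub m n} →
                Reducible (⨂ Γs) σ → ∀ i → Reducible (Γs i) σ
  Reducible-⨂ {k = suc k} Γs e zero    = proj₁ (Reducible-⊗ (Γs zero) (⨂ (Γs ∘ suc)) e)
  Reducible-⨂ {k = suc k} Γs e (suc i) =
    Reducible-⨂ (Γs ∘ suc) (proj₂ (Reducible-⊗ (Γs zero) (⨂ (Γs ∘ suc)) e)) i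

  Reducible-rename : ∀ {m n k} (Δ : Ctx m) {σ : Sub m n} (ρ : Ren n k) →
                     Reducible Δ σ → Reducible Δ (rename ρ ∘ σ)
  Reducible-rename Δ ρ e j = RL-rename (Vec.lookup Δ j) ρ (e j)

  -- Going under a binder: the lifted substitution is reducible at as ∷ Δ,
  -- because the new variable is neutral.
  Reducible-lift : ∀ {m n} (Δ : Ctx m) {σ : Sub m n} as →
                   Reducible Δ σ → Reducible (as ∷ Δ) (liftSub σ)
  Reducible-lift Δ as e zero    = RL-tabulate as (λ i → R-neutral _ (nvar zero))
  Reducible-lift Δ as e (suc j) = Reducible-rename Δ suc e j

  Reducible-var : ∀ {n} (Δ : Ctx n) → Reducible Δ var
  Reducible-var Δ j = RL-tabulate (Vec.lookup Δ j) (λ i → R-neutral _ (nvar j))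

  -- Fundamental lemma: typable terms are reducible under reducible
  -- substitutions.  The (abs) case uses head expansion, since a β-redex
  -- (λx.M[σ]) N head-reduces to M[N, σ].
  fundamental : ∀ {m n} {Δ : Ctx m} {M : Term m} {a} → Δ ⊢ M ∶ a →
                (σ : Sub m n) → Reducible Δ σ → R a (subst σ M)
  fundamental (tvar i _ g) σ e = proj₁ (RL-map g (e i))
  fundamental {Δ = Δ} (tabs {as = as} {a = a} {M = M} d) σ e =
    HN-lam (R⇒HN a (fundamental d (liftSub σ) (Reducible-lift Δ as e))) , applied
    where
    redex : ∀ {k} (ρ : Ren _ k) N →
            (rename (liftRen ρ) (subst (liftSub σ) M)) [ N ] ≡ subst (ext N (rename ρ ∘ σ)) M
    redex ρ N = begin
      (rename (liftRen ρ) (subst (liftSub σ) M)) [ N ]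
        ≡⟨ cong (_[ N ]) (rename-subst (liftRen ρ) (liftSub σ) M) ⟩
      (subst (rename (liftRen ρ) ∘ liftSub σ) M) [ N ]
        ≡⟨ cong (_[ N ]) (subst-ext (rename-liftSub ρ σ) M) ⟩
      (subst (liftSub (rename ρ ∘ σ)) M) [ N ]
        ≡⟨ subst-beta (rename ρ ∘ σ) M N ⟩
      subst (ext N (rename ρ ∘ σ)) M ∎

    applied : ∀ {k} (ρ : Ren _ k) N → RL as N →
              R a (app (rename ρ (subst σ (lam M))) N)
    applied ρ N rs = R-expand a _ N (transport (R a) (sym (redex ρ N))
      (fundamental d (ext N (rename ρ ∘ σ))
        (λ { zero → rs ; (suc j) → Reducible-rename Δ ρ e j })))
  fundamental {Δ = Δ} (tapp {Γ₀ = Γ₀} {as = as} dM Γs dN η) σ e =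
    transport (λ t → R _ (app t _)) (rename-id _)
      (proj₂ (fundamental dM σ eM) id _
        (RL-tabulate as (λ i → fundamental (dN i) σ (Reducible-⨂ Γs eN i))))
    where
    split : Reducible Γ₀ σ × Reducible (⨂ Γs) σ
    split = Reducible-⊗ Γ₀ (⨂ Γs) (Reducible-map Δ (Γ₀ ⊗ ⨂ Γs) η e)

    eM : Reducible Γ₀ σ
    eM = proj₁ split

    eN : Reducible (⨂ Γs) σ
    eN = proj₂ split

  typable⇒HN : ∀ {n} (M : Term n) → Typable M → HN M
  typable⇒HN M (Δ , a , d) =
    R⇒HN a (transport (R a) (subst-id M) (fundamental d var (Reducible-var Δ)))

lemma8 : (𝒞 : FunClass) (A : Category) {n : ℕ} (M : Term n) →
         System.Typable 𝒞 A M → HeadReductionEnds M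
lemma8 𝒞 A M typable = HN⇒ends (Reducibility.typable⇒HN 𝒞 A M typable)
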